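{- Let $G$ and $H$ be two nontrivial connected graphs and let $S\subseteq V(G)$ and $T\subseteq V(H)$ be (cycle) convex sets in $G$ and $H$ respectively. Then $S\times T$ is (cycle) convex in $G\Box H$.
   Context: All graphs are finite, simple and undirected. Cycle convexity on a graph $G$: for $S\subseteq V(G)$, the cycle interval $\langle S\rangle$ is $S$ together with every vertex $w\in V(G)$ that lies on a cycle of the induced subgraph $G[S\cup\{w\}]$ passing through $w$. $S$ is (cycle) convex if $\langle S\rangle=S$. The Cartesian product $G\Box H$ has vertex set $V(G)\times V(H)$, with $(g_1,h_1)\sim(g_2,h_2)$ iff ($g_1\sim g_2$ and $h_1=h_2$) or ($g_1=g_2$ and $h_1\sim h_2$). A graph is nontrivial if it has at least two vertices. -}

module Defs where

open import Data.Nat using (ℕ; _≤_)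
open import Data.Fin using (Fin)
open import Data.List using (List; []; _∷_; _++_; [_]; length)
open import Data.List.Relation.Unary.All using (All)
open import Data.List.Relation.Unary.Linked using (Linked)
open import Data.List.Relation.Unary.Unique.Propositional using (Unique)
open import Data.List.Membership.Propositional using (_∈_)
open import Data.Product using (Σ; _×_; ∃; _,_)
open import Data.Sum using (_⊎_; inj₁; inj₂)
open import Relation.Binary.PropositionalEquality using (_≡_; _≢_; refl; sym)
open import Data.Nat using (_*_)
open import Data.Fin.Properties using (*↔×)
open import Data.Product.Function.NonDependent.Propositional using (_×-↔_)
open import Function.Properties.Inverse using (↔-sym; ↔-trans)
open import Relation.Nullary using (¬_)
open import Data.Empty using (⊥)
open import Function.Bundles using (_↔_)

record Graph (V : Set) : Set₁ where
  field
    _~_    : V → V → Set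
    ~-sym  : ∀ {u v} → u ~ v → v ~ u
    ~-irr  : ∀ {v} → ¬ (v ~ v)
    finite : Σ ℕ λ n → V ↔ Fin n
open Graph public

VSet : Set → Set₁
VSet V = V → Set

data Reach {V : Set} (G : Graph V) (u : V) : V → Set where
  here : Reach G u u
  step : ∀ {v w} → Reach G u v → _~_ G v w → Reach G u w

Connected : ∀ {V} → Graph V → Set
Connected {V} G = ∀ (u v : V) → Reach G u v

Nontrivial : ∀ {V} → Graph V → Set
Nontrivial {V} G = Σ V λ u → Σ V λ v → u ≢ v

IsCycle : ∀ {V} → Graph V → List V → Set
IsCycle G []       = ⊥
IsCycle G (x ∷ xs) =
  (3 ≤ length (x ∷ xs)) × Unique (x ∷ xs) × Linked (_~_ G) ((x ∷ xs) ++ [ x ])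

-- w lies on a cycle of the induced subgraph G[S ∪ {w}] passing through w.
OnCycleWith : ∀ {V} → Graph V → VSet V → V → Set
OnCycleWith {V} G S w =
  Σ (List V) λ c → IsCycle G c × All (λ v → S v ⊎ v ≡ w) c × w ∈ c

Interval : ∀ {V} → Graph V → VSet V → VSet V
Interval G S w = S w ⊎ OnCycleWith G S w

Convex : ∀ {V} → Graph V → VSet V → Set
Convex {V} G S = (∀ (v : V) → S v → Interval G S v) × (∀ (v : V) → Interval G S v → S v)

_□_ : ∀ {V W} → Graph V → Graph W → Graph (V × W)
_□_ {V} {W} G H = record { _~_ = adj ; ~-sym = asym ; ~-irr = airr ; finite = fin }
  where
  adj : V × W → V × W → Set
  adj (g₁ , h₁) (g₂ , h₂) = (_~_ G g₁ g₂ × h₁ ≡ h₂) ⊎ (g₁ ≡ g₂ × _~_ H h₁ h₂)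
  asym : ∀ {u v} → adj u v → adj v u
  asym (inj₁ (e , p)) = inj₁ (~-sym G e , sym p)
  asym (inj₂ (p , e)) = inj₂ (sym p , ~-sym H e)
  airr : ∀ {v} → ¬ adj v v
  airr (inj₁ (e , _)) = ~-irr G e
  airr (inj₂ (_ , e)) = ~-irr H e
  fin : Σ ℕ λ n → (V × W) ↔ Fin n
  fin with finite G | finite H
  ... | n , f | m , g = n * m , ↔-trans (f ×-↔ g) (↔-sym *↔×)

_⊠_ : ∀ {V W} → VSet V → VSet W → VSet (V × W)
(S ⊠ T) (g , h) = S g × T h

{-# OPTIONS --safe #-}
module Submission where

-- If (g , h) lies on a cycle of (G □ H)[S × T ∪ {(g , h)}], its two neighbours a ≠ b on the
-- cycle are joined by the rest of the cycle, a walk inside S × T: a detour around (g , h).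
-- If both edges at (g , h) are G-edges, projecting to G gives a detour around g inside S;
-- unless g is on it, loop-erasing it and closing it up through g gives a cycle of
-- G[S ∪ {g}] through g, so g ∈ S by convexity, while h ∈ T since a ∈ S × T. Two H-edges
-- are symmetric, and if the edges are of different kinds then a and b already give
-- g ∈ S and h ∈ T.

open import Defs
open import Data.Nat using (_≤_; s≤s; z≤n)
import Data.Fin.Properties as Fin
open import Data.List using (List; []; _∷_; _++_; [_]; length; map)
open import Data.List.Properties using (++-assoc)
open import Data.List.Relation.Unary.All as All using (All; []; _∷_)
open import Data.List.Relation.Unary.All.Properties using (¬Any⇒All¬; anti-mono; map⁺)
open import Data.List.Relation.Unary.Any using (here; there)
open import Data.List.Relation.Unary.AllPairs using ([]; _∷_)
open import Data.List.Relation.Unary.Linked using (Linked; [-]; _∷_)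
open import Data.List.Relation.Unary.Unique.Propositional using (Unique)
open import Data.List.Membership.Propositional using (_∈_; _∉_)
open import Data.List.Membership.Propositional.Properties using (∈-∃++)
import Data.List.Membership.DecPropositional as DecMembership
open import Data.List.Relation.Binary.Subset.Propositional using (_⊆_)
open import Data.List.Relation.Binary.Subset.Propositional.Properties using (⊆-refl; ∷⁺ʳ)
open import Data.List.Relation.Binary.Permutation.Propositional using (_↭_; ↭-refl; ↭⇒↭ₛ)
open import Data.List.Relation.Binary.Permutation.Propositional.Properties using (All-resp-↭; ↭-length; ++-comm)
open import Data.List.Relation.Binary.Permutation.Setoid.Properties using (Unique-resp-↭)
open import Data.Product using (Σ-syntax; _×_; _,_; proj₁; proj₂)
import Data.Product as Product
open import Data.Sum using (_⊎_; inj₁; inj₂)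
open import Data.Empty using (⊥-elim)
open import Function using (_∘_)
open import Function.Properties.Inverse using (↔⇒↣)
open import Relation.Binary.Definitions using (DecidableEquality)
open import Relation.Binary.PropositionalEquality using (_≡_; _≢_; refl; sym; cong; subst; setoid)
open import Relation.Nullary using (yes; no)
open import Relation.Nullary.Decidable using (via-injection)

module _ {A : Set} {R : A → A → Set} {x : A} {ys : List A} where

  linked-++-∷⁻ : ∀ xs → Linked R (xs ++ x ∷ ys) → Linked R (xs ++ [ x ]) × Linked R (x ∷ ys)
  linked-++-∷⁻ []           l       = [-] , l
  linked-++-∷⁻ (_ ∷ [])     (r ∷ l) = r ∷ [-] , l
  linked-++-∷⁻ (_ ∷ y ∷ xs) (r ∷ l) = Product.map₁ (r ∷_) (linked-++-∷⁻ (y ∷ xs) l)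

  linked-++-∷⁺ : ∀ xs → Linked R (xs ++ [ x ]) → Linked R (x ∷ ys) → Linked R (xs ++ x ∷ ys)
  linked-++-∷⁺ []           _         l  = l
  linked-++-∷⁺ (_ ∷ [])     (r ∷ [-]) l  = r ∷ l
  linked-++-∷⁺ (_ ∷ y ∷ xs) (r ∷ l₁)  l₂ = r ∷ linked-++-∷⁺ (y ∷ xs) l₁ l₂

module _ {V : Set} where

  private
    variable
      G : Graph V
      S : VSet V
      a b u v w x : V
      xs : List V

  vertex-≟ : Graph V → DecidableEquality V
  vertex-≟ G = via-injection (↔⇒↣ (proj₂ (finite G))) Fin._≟_

  data Walk (G : Graph V) : V → V → Set where
    []  : ∀ {u} → Walk G u u
    _∷_ : ∀ {u v w} → _~_ G u v → Walk G v w → Walk G u w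

  -- Splitting off the start makes vertices p reduce to a cons for every p.
  verticesAfterStart : Walk G u v → List V
  verticesAfterStart []                = []
  verticesAfterStart (_∷_ {v = v} _ p) = v ∷ verticesAfterStart p

  vertices : Walk G u v → List V
  vertices {u = u} p = u ∷ verticesAfterStart p

  last∈vertices : (p : Walk G u v) → v ∈ vertices p
  last∈vertices []      = here refl
  last∈vertices (_ ∷ p) = there (last∈vertices p)

  vertices-linked : (p : Walk G u v) → _~_ G v w → Linked (_~_ G) (vertices p ++ [ w ])
  vertices-linked []       v~w = v~w ∷ [-]
  vertices-linked (u~ ∷ p) v~w = u~ ∷ vertices-linked p v~w

  linked⇒walk : Linked (_~_ G) (a ∷ xs ++ [ w ]) → Σ[ b ∈ V ] Σ[ p ∈ Walk G a b ] vertices p ≡ a ∷ xs × _~_ G b w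
  linked⇒walk {xs = []}             (a~w ∷ [-])    = _ , [] , refl , a~w
  linked⇒walk {a = a} {xs = _ ∷ _} (a~ ∷ linked) with linked⇒walk linked
  ... | b , p , eq , b~w = b , a~ ∷ p , cong (a ∷_) eq , b~w

  ends-distinct : (p : Walk G a b) → Unique (vertices p) → 2 ≤ length (vertices p) → a ≢ b
  ends-distinct []      _           (s≤s ())
  ends-distinct (_ ∷ p) (a∉p ∷ _) _ = All.lookup a∉p (last∈vertices p)

  module _ (G : Graph V) where

    open DecMembership (vertex-≟ G) using (_∈?_)

    suffixFrom : (p : Walk G v w) → u ∈ vertices p → Unique (vertices p)
               → Σ[ q ∈ Walk G u w ] Unique (vertices q) × vertices q ⊆ vertices p
    suffixFrom p       (here refl) uniq       = p , uniq , ⊆-refl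
    suffixFrom (_ ∷ p) (there u∈p) (_ ∷ uniq) with suffixFrom p u∈p uniq
    ... | q , uniq′ , q⊆p = q , uniq′ , λ v∈q → there (q⊆p v∈q)

    loopErase : (p : Walk G u w) → Σ[ q ∈ Walk G u w ] Unique (vertices q) × vertices q ⊆ vertices p
    loopErase []                = [] , [] ∷ [] , ⊆-refl
    loopErase {u = u} (u~ ∷ p) with loopErase p
    ... | q , uniq , q⊆p with u ∈? vertices q
    ...   | yes u∈q = Product.map₂ (Product.map₂ λ r⊆q v∈r → there (q⊆p (r⊆q v∈r))) (suffixFrom q u∈q uniq)
    ...   | no  u∉q = u~ ∷ q , ¬Any⇒All¬ _ u∉q ∷ uniq , ∷⁺ʳ u q⊆p

  cycle-closing : _~_ G w a → _~_ G b w → a ≢ b → (p : Walk G a b)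
                → Unique (vertices p) → w ∉ vertices p → IsCycle G (w ∷ vertices p)
  cycle-closing w~a b~w a≢b []          _    _   = ⊥-elim (a≢b refl)
  cycle-closing w~a b~w a≢b p@(_ ∷ _) uniq w∉p =
    s≤s (s≤s (s≤s z≤n)) , ¬Any⇒All¬ _ w∉p ∷ uniq , w~a ∷ vertices-linked p b~w

  record Detour (G : Graph V) (S : VSet V) (w : V) : Set where
    constructor detour
    field
      {start end} : V
      w~start     : _~_ G w start
      end~w       : _~_ G end w
      start≢end   : start ≢ end
      walk        : Walk G start end
      walk⊆S      : All S (vertices walk)

  detour⇒interval : Detour G S w → Interval G S w
  detour⇒interval {G = G} {w = w} (detour w~a b~w a≢b p p⊆S) with w ∈? vertices p
    where open DecMembership (vertex-≟ G) using (_∈?_)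
  ... | yes w∈p = inj₁ (All.lookup p⊆S w∈p)
  ... | no  w∉p with loopErase G p
  ...   | q , uniq , q⊆p =
    inj₂ ( w ∷ vertices q
         , cycle-closing w~a b~w a≢b q uniq (w∉p ∘ q⊆p)
         , inj₂ refl ∷ All.map inj₁ (anti-mono q⊆p p⊆S)
         , here refl)

  cycle-rotate : ∀ pre post → IsCycle G (x ∷ pre ++ w ∷ post) → IsCycle G (w ∷ post ++ x ∷ pre)
  cycle-rotate {G = G} {x = x} {w = w} pre post (long , uniq , linked)
    with linked-++-∷⁻ (x ∷ pre) (subst (Linked (_~_ G) ∘ (x ∷_)) (++-assoc pre (w ∷ post) [ x ]) linked)
  ... | x…w , w…x =
      subst (3 ≤_) (↭-length rotation) long
    , Unique-resp-↭ (setoid V) (↭⇒↭ₛ rotation) uniq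
    , subst (Linked (_~_ G) ∘ (w ∷_)) (sym (++-assoc post (x ∷ pre) [ w ]))
        (linked-++-∷⁺ (w ∷ post) w…x x…w)
    where
    rotation : x ∷ pre ++ w ∷ post ↭ w ∷ post ++ x ∷ pre
    rotation = ++-comm (x ∷ pre) (w ∷ post)

  cycle-rotate-to : ∀ {c} → IsCycle G c → w ∈ c → Σ[ ys ∈ List V ] IsCycle G (w ∷ ys) × c ↭ w ∷ ys
  cycle-rotate-to {c = _ ∷ xs} cyc (here refl) = xs , cyc , ↭-refl
  cycle-rotate-to {G = G} {w = w} {c = x ∷ _} cyc (there w∈xs) with ∈-∃++ w∈xs
  ... | pre , post , refl = post ++ x ∷ pre , cycle-rotate {G = G} pre post cyc , ++-comm (x ∷ pre) (w ∷ post)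

  All-⊎≡-elim : All (λ v → S v ⊎ v ≡ w) xs → All (w ≢_) xs → All S xs
  All-⊎≡-elim {S = S} {w = w} in-S∪w w∉xs = All.zipWith resolve (in-S∪w , w∉xs)
    where
    resolve : ∀ {v} → (S v ⊎ v ≡ w) × w ≢ v → S v
    resolve (inj₁ v∈S , _)    = v∈S
    resolve (inj₂ refl , w≢w) = ⊥-elim (w≢w refl)

  cycle⇒detour : OnCycleWith G S w → Detour G S w
  cycle⇒detour {S = S} (c , cyc , c⊆S∪w , w∈c) with cycle-rotate-to cyc w∈c
  ... | [] , (s≤s () , _) , _
  ... | a ∷ xs , (s≤s long , w∉ys ∷ uniq , w~a ∷ linked) , c↭w∷ys with linked⇒walk linked
  ...   | b , p , vertices≡ , b~w
    with subst (λ zs → Unique zs × 2 ≤ length zs × All S zs) (sym vertices≡)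
               (uniq , long , All-⊎≡-elim (All.tail (All-resp-↭ c↭w∷ys c⊆S∪w)) w∉ys)
  ...     | uniq′ , long′ , p⊆S = detour w~a b~w (ends-distinct p uniq′ long′) p p⊆S

module _ {V W : Set} {G : Graph V} {H : Graph W} where

  private
    variable
      g g′ : V
      h h′ : W

  project₁ : (p : Walk (G □ H) (g , h) (g′ , h′)) → Σ[ q ∈ Walk G g g′ ] vertices q ⊆ map proj₁ (vertices p)
  project₁ []                    = [] , ⊆-refl
  project₁ (inj₁ (g~ , refl) ∷ p) = Product.map (g~ ∷_) (∷⁺ʳ _) (project₁ p)
  project₁ (inj₂ (refl , _) ∷ p)  = Product.map₂ (λ q⊆p v∈q → there (q⊆p v∈q)) (project₁ p)

  project₂ : (p : Walk (G □ H) (g , h) (g′ , h′)) → Σ[ q ∈ Walk H h h′ ] vertices q ⊆ map proj₂ (vertices p)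
  project₂ []                    = [] , ⊆-refl
  project₂ (inj₁ (_ , refl) ∷ p)  = Product.map₂ (λ q⊆p v∈q → there (q⊆p v∈q)) (project₂ p)
  project₂ (inj₂ (refl , h~) ∷ p) = Product.map (h~ ∷_) (∷⁺ʳ _) (project₂ p)

  module _ {S : VSet V} {T : VSet W} where

    project-detour₁ : {a b : V} → _~_ G g a → _~_ G b g → (a , h) ≢ (b , h)
                    → (p : Walk (G □ H) (a , h) (b , h)) → All (S ⊠ T) (vertices p) → Detour G S g
    project-detour₁ g~a b~g a≢b p p⊆S⊠T =
      let q , q⊆p = project₁ p
      in detour g~a b~g (a≢b ∘ cong (_, _)) q (anti-mono q⊆p (map⁺ (All.map proj₁ p⊆S⊠T)))

    project-detour₂ : {a b : W} → _~_ H h a → _~_ H b h → (g , a) ≢ (g , b)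
                    → (p : Walk (G □ H) (g , a) (g , b)) → All (S ⊠ T) (vertices p) → Detour H T h
    project-detour₂ h~a b~h a≢b p p⊆S⊠T =
      let q , q⊆p = project₂ p
      in detour h~a b~h (a≢b ∘ cong (_ ,_)) q (anti-mono q⊆p (map⁺ (All.map proj₂ p⊆S⊠T)))

    ⊠-detour-closed : Convex G S → Convex H T → Detour (G □ H) (S ⊠ T) (g , h) → (S ⊠ T) (g , h)
    ⊠-detour-closed {g = g} {h = h} convexS convexT (detour w~a b~w a≢b p p⊆S⊠T)
      with All.head p⊆S⊠T | All.lookup p⊆S⊠T (last∈vertices p) | w~a | b~w
    ... | _ , h∈T | _ | inj₁ (g~a , refl) | inj₁ (b~g , refl) =
      proj₂ convexS g (detour⇒interval (project-detour₁ g~a b~g a≢b p p⊆S⊠T)) , h∈T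
    ... | g∈S , _ | _ | inj₂ (refl , h~a) | inj₂ (refl , b~h) =
      g∈S , proj₂ convexT h (detour⇒interval (project-detour₂ h~a b~h a≢b p p⊆S⊠T))
    ... | _ , h∈T | g∈S , _ | inj₁ (_ , refl) | inj₂ (refl , _) = g∈S , h∈T
    ... | g∈S , _ | _ , h∈T | inj₂ (refl , _) | inj₁ (_ , refl) = g∈S , h∈T

mainTheorem12 : ∀ {V W : Set} (G : Graph V) (H : Graph W)
    → Nontrivial G → Connected G → Nontrivial H → Connected H
    → (S : VSet V) (T : VSet W) → Convex G S → Convex H T
    → Convex (G □ H) (S ⊠ T)
mainTheorem12 G H _ _ _ _ S T convexS convexT = (λ _ → inj₁) , λ where
  _ (inj₁ v∈S⊠T) → v∈S⊠T
  _ (inj₂ onCycle) → ⊠-detour-closed convexS convexT (cycle⇒detour onCycle)
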